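{- Let $S$ be a finite non-empty set, let $b$ be an integer-valued submodular set-function on $S$ (the value $+\infty$ allowed) with $b(\emptyset)=0$ and $b(S)$ finite, and let $p$ be its complementary function, $p(X)=b(S)-b(S-X)$ for $X\subseteq S$. Let $B=B(b)=B'(p)$ and let $m$ be an integral element of $B$. Then the following four conditions are pairwise equivalent: (A) There is no 1-tightening step for $m$. (B) There is a chain $\emptyset\subset C_1\subset C_2\subset\cdots\subset C_\ell=S$ of $m$-top sets, each of which is $m$-tight with respect to $p$ (equivalently, whose complements are $m$-tight with respect to $b$), such that for the partition $\{S_1,\dots,S_\ell\}$ of $S$ given by $S_1=C_1$ and $S_i=C_i-C_{i-1}$ $(i=2,\dots,\ell)$, the restriction $m|S_i$ is near-uniform for each $i$. (C1) $m$ is decreasingly minimal in $B\cap\mathbb{Z}^S$. (C2) $m$ is increasingly maximal in $B\cap\mathbb{Z}^S$.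
   Context: For $x\in\mathbb{R}^S$ and $X\subseteq S$ write $\widetilde x(X)=\sum_{s\in X}x(s)$. $b$ submodular means $b(X)+b(Y)\ge b(X\cap Y)+b(X\cup Y)$ whenever $b(X),b(Y)$ are finite. $B(b)=\{x\in\mathbb{R}^S:\widetilde x(S)=b(S),\ \widetilde x(Z)\le b(Z)\ \forall Z\subset S\}$ and $B'(p)=\{x\in\mathbb{R}^S:\widetilde x(S)=p(S),\ \widetilde x(Z)\ge p(Z)\ \forall Z\subset S\}$; these coincide. For $m\in B\cap\mathbb{Z}^S$: a set $X$ is $m$-tight with respect to $p$ if $\widetilde m(X)=p(X)$, and $m$-tight with respect to $b$ if $\widetilde m(X)=b(X)$. A set $X\subseteq S$ is an $m$-top set if $m(u)\ge m(v)$ whenever $u\in X$, $v\in S-X$. A vector is near-uniform if its largest and smallest components differ by at most 1. A 1-tightening step for $m$ is a pair $s,t\in S$ with $m(t)\ge m(s)+2$ and $m+\chi_s-\chi_t\in B\cap\mathbb{Z}^S$ ($\chi_u$ the unit vector of $u$). For $x\in\mathbb{R}^S$ let $x{\downarrow}$ ($x{\uparrow}$) be the vector of its components in decreasing (increasing) order. $x<_{\rm dec}y$ if $x{\downarrow}\ne y{\downarrow}$ and $x{\downarrow}(j)<y{\downarrow}(j)$ for the first index $j$ where they differ; $x\le_{\rm dec}y$ if $x<_{\rm dec}y$ or $x{\downarrow}=y{\downarrow}$. An element $m$ of a set $Q$ is decreasingly minimal (dec-min) in $Q$ if $m\le_{\rm dec}y$ for all $y\in Q$. Analogously $y>_{\rm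 inc}x$ if $y{\uparrow}\neq x{\uparrow}$ and $y{\uparrow}(j)>x{\uparrow}(j)$ at the first differing index; $m$ is increasingly maximal (inc-max) in $Q$ if $m\ge_{\rm inc} y$ (i.e. $m>_{\rm inc}y$ or value-equivalent) for all $y\in Q$. -}

module Defs where

open import Data.Nat using (ℕ; zero; suc)
open import Data.Integer using (ℤ; _+_; _-_; _≤_; _<_; 0ℤ; 1ℤ; +_)
open import Data.Integer.Properties using (≤-decTotalOrder)
open import Data.Fin using (Fin; zero; suc; inject₁; fromℕ; _≟_)
open import Data.Fin.Subset using (Subset; _∈_; _∉_; _⊂_; _∩_; _∪_; _─_; ∁; ⊤; ⊥)
open import Data.Vec using (lookup)
open import Data.Bool using (Bool; true; false; if_then_else_)
open import Data.List using (List; []; _∷_; reverse)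
import Data.List.Sort ≤-decTotalOrder as Sort
open import Data.Vec.Functional using (toList)
open import Data.Product using (Σ; _×_; _,_; ∃)
open import Data.Maybe using (Maybe; just; nothing)
open import Relation.Binary.PropositionalEquality using (_≡_; _≢_)
open import Relation.Nullary using (¬_; yes; no)
open import Data.Fin.Subset using (Side; inside; outside)

data ℤ∞ : Set where
  fin : ℤ → ℤ∞
  ∞   : ℤ∞

infix 4 _≤∞_
data _≤∞_ : ℤ∞ → ℤ∞ → Set where
  fin≤fin : ∀ {a c} → a ≤ c → fin a ≤∞ fin c
  _≤∞top  : ∀ x → x ≤∞ ∞

infixl 6 _+∞_
_+∞_ : ℤ∞ → ℤ∞ → ℤ∞
fin a +∞ fin c = fin (a + c)
_     +∞ _     = ∞

SetFn : ℕ → Set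
SetFn n = Subset n → ℤ∞

Submodular : ∀ {n} → SetFn n → Set
Submodular {n} b = ∀ (X Y : Subset n) (a c : ℤ) → b X ≡ fin a → b Y ≡ fin c →
  b (X ∩ Y) +∞ b (X ∪ Y) ≤∞ fin (a + c)

-- Complementary function p(X) = b(S) - b(S - X), values in ℤ ∪ {-∞};
-- nothing represents -∞ (occurs iff b(S-X) = +∞, b(S) being finite).
compl : ∀ {n} → SetFn n → Subset n → Maybe ℤ
compl b X with b ⊤ | b (∁ X)
... | fin bS | fin c = just (bS - c)
... | _      | _     = nothing

∑ : ∀ {n} → (Fin n → ℤ) → ℤ
∑ {zero}  f = 0ℤ
∑ {suc n} f = f zero + ∑ (λ i → f (suc i))

tilde : ∀ {n} → (Fin n → ℤ) → Subset n → ℤ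
tilde x X = ∑ (λ i → if isIn (lookup X i) then x i else 0ℤ)
  where
  isIn : Side → Bool
  isIn s = s

InB : ∀ {n} → SetFn n → (Fin n → ℤ) → Set
InB {n} b x = (b ⊤ ≡ fin (tilde x ⊤)) × (∀ (Z : Subset n) → Z ⊂ ⊤ → fin (tilde x Z) ≤∞ b Z)

χ : ∀ {n} → Fin n → Fin n → ℤ
χ u v with u ≟ v
... | yes _ = 1ℤ
... | no  _ = 0ℤ

TightP : ∀ {n} → SetFn n → (Fin n → ℤ) → Subset n → Set
TightP b m X = compl b X ≡ just (tilde m X)

Top : ∀ {n} → (Fin n → ℤ) → Subset n → Set
Top {n} m X = ∀ (u v : Fin n) → u ∈ X → v ∉ X → m v ≤ m u

NearUniformOn : ∀ {n} → (Fin n → ℤ) → Subset n → Set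
NearUniformOn {n} m Y = ∀ (u v : Fin n) → u ∈ Y → v ∈ Y → m u ≤ m v + 1ℤ

TighteningStep : ∀ {n} → SetFn n → (Fin n → ℤ) → Fin n → Fin n → Set
TighteningStep b m s t =
  (m s + + 2 ≤ m t) × InB b (λ u → m u + χ s u - χ t u)

-- Condition (B): chain ∅ ⊂ C_1 ⊂ ... ⊂ C_ℓ = S, ℓ = suc k, indexed by Fin (suc k)
part : ∀ {n k} → (Fin (suc k) → Subset n) → Fin (suc k) → Subset n
part C zero    = C zero
part C (suc j) = C (suc j) ─ C (inject₁ j)

ChainCond : ∀ {n} → SetFn n → (Fin n → ℤ) → Set
ChainCond {n} b m = Σ ℕ λ k → Σ (Fin (suc k) → Subset n) λ C →
    (⊥ ⊂ C zero)
  × (∀ (j : Fin k) → C (inject₁ j) ⊂ C (suc j))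
  × (C (fromℕ k) ≡ ⊤)
  × (∀ i → Top m (C i))
  × (∀ i → TightP b m (C i))
  × (∀ i → NearUniformOn m (part C i))

data LexLess : List ℤ → List ℤ → Set where
  here  : ∀ {x y xs ys} → x < y → LexLess (x ∷ xs) (y ∷ ys)
  there : ∀ {x xs ys} → LexLess xs ys → LexLess (x ∷ xs) (x ∷ ys)

_↑ : ∀ {n} → (Fin n → ℤ) → List ℤ
x ↑ = Sort.sort (toList x)

_↓ : ∀ {n} → (Fin n → ℤ) → List ℤ
x ↓ = reverse (x ↑)

_<dec_ : ∀ {n} → (Fin n → ℤ) → (Fin n → ℤ) → Set
x <dec y = LexLess (x ↓) (y ↓)

_≤dec_ : ∀ {n} → (Fin n → ℤ) → (Fin n → ℤ) → Set
x ≤dec y = (x <dec y) Data.Sum.⊎ (x ↓ ≡ y ↓)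
  where import Data.Sum

_>inc_ : ∀ {n} → (Fin n → ℤ) → (Fin n → ℤ) → Set
y >inc x = LexLess (x ↑) (y ↑)

_≥inc_ : ∀ {n} → (Fin n → ℤ) → (Fin n → ℤ) → Set
y ≥inc x = (y >inc x) Data.Sum.⊎ (y ↑ ≡ x ↑)
  where import Data.Sum

DecMin : ∀ {n} → SetFn n → (Fin n → ℤ) → Set
DecMin {n} b m = ∀ (y : Fin n → ℤ) → InB b y → m ≤dec y

IncMax : ∀ {n} → SetFn n → (Fin n → ℤ) → Set
IncMax {n} b m = ∀ (y : Fin n → ℤ) → InB b y → m ≥inc y

NoTighteningStep : ∀ {n} → SetFn n → (Fin n → ℤ) → Set
NoTighteningStep {n} b m = ∀ (s t : Fin n) → ¬ TighteningStep b m s t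

-- Let excess x r = Σᵢ (xᵢ − r)⁺ and deficit x r = Σᵢ (r − xᵢ)⁺. For vectors of the same length,
-- excess x ≤ excess y at every threshold r forces x ≤dec y, and deficit x ≤ deficit y forces
-- x ≥inc y; on B, where Σ x is fixed, deficit and excess differ by a term independent of x.
--
-- A 1-tightening step m ↦ m + χ_s − χ_t lowers excess weakly at every r and strictly at
-- r = m(s) + 1, so it cannot exist when m is dec-min or inc-max. Given a chain as in (B) and a
-- threshold r, the first chain set C containing every u with m(u) > r has all its values ≥ r (by
-- the top property and near-uniformity of its last part), so excess m r = m̃(C) − r|C|; since C is
-- p-tight, m̃(C) ≤ ỹ(C) for y ∈ B, whence excess m ≤ excess y. Finally, without tightening steps
-- any s, t with m(t) ≥ m(s) + 2 are separated by a b-tight set, and b-tight sets are closed under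
-- ∩ and ∪ by submodularity; so for every γ some b-tight D contains {m < γ} and misses {m > γ}.
-- Starting from D = S and repeatedly taking γ one below the maximum of m on D, the complements
-- of these sets form the chain of (B).

module Submission where

open import Defs
open import Data.Nat as ℕ using (ℕ; zero; suc)
import Data.Nat.Properties as ℕ
open import Data.Integer
  using (ℤ; 0ℤ; 1ℤ; -1ℤ; pred; +_; _+_; _-_; -_; _≤_; _<_; +≤+; +<+; _⊔_) renaming (suc to sucℤ)
import Data.Integer.Properties as ℤ
open import Data.Integer.Tactic.RingSolver using (solve-∀)
open import Data.Fin using (Fin; zero; suc; inject₁; fromℕ)
import Data.Fin.Properties as Fin
open import Data.Fin.Subset using (Subset; Nonempty; _∈_; _∉_; _∩_; _∪_; ∁; ⊤; ⊥; _─_; _⊂_; ⋂; ⋃)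
open import Data.Fin.Subset.Properties
  using ( _∈?_; ∈⊤; ∉⊥; ⊆⊤; ⊆-antisym; anySubset?; nonempty?; Empty-unique; p─⊥≡p; p─q⊆p; p⊂q⇒∁p⊃∁q
        ; x∈p∩q⁺; x∈p∩q⁻; x∈p∪q⁺; x∈p∪q⁻; x∈∁p⇒x∉p; x∉∁p⇒x∈p; x∉p⇒x∈∁p; x∈p∧x∉q⇒x∈p─q )
open import Data.Fin.Subset.Induction using (⊂-wellFounded)
open import Data.Vec using ([]; _∷_; lookup; there)
import Data.Vec.Properties as Vec
open import Data.Vec.Functional using (toList)
open import Data.Bool using (true; false; if_then_else_; not; _∧_; _∨_)
open import Data.Bool.Properties using (not-involutive)
open import Data.Maybe using (just)
open import Data.Product as Product using (_×_; _,_; ∃; proj₁; proj₂)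
open import Data.Sum as Sum using (_⊎_; inj₁; inj₂)
open import Data.Empty using (⊥-elim)
open import Data.List as List using (List; []; _∷_; foldr; map; length; reverse)
import Data.List.Properties as List
import Data.List.Extrema as Extrema
open import Data.List.Membership.Propositional.Properties using (∈-filter⁺; ∈-allFin)
open import Data.List.Relation.Unary.All as All using (All; []; _∷_)
import Data.List.Relation.Unary.All.Properties as All
import Data.List.Relation.Unary.Any.Properties as Any
open import Data.List.Relation.Unary.AllPairs using (AllPairs; []; _∷_)
import Data.List.Relation.Unary.AllPairs.Properties as AllPairs
import Data.List.Relation.Unary.Linked.Properties as Linked
open import Data.List.Relation.Binary.Permutation.Propositional using (_↭_; ↭-sym; ↭-trans; ↭⇒↭ₛ)
import Data.List.Relation.Binary.Permutation.Propositional.Properties as ↭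
import Data.List.Sort ℤ.≤-decTotalOrder as Sort
open import Function using (_∘_; flip; id)
open import Function.Bundles using (_⇔_; mk⇔)
open import Induction.WellFounded using (Acc; acc)
open import Relation.Binary.Definitions using (tri<; tri≈; tri>)
open import Relation.Binary.PropositionalEquality
open import Relation.Nullary using (¬_; yes; no; Dec; ¬?)
open import Relation.Nullary.Decidable as Dec using (decidable-stable; _×-dec_)

+-cancelˡ-≤ : ∀ k {i j} → k + i ≤ k + j → i ≤ j
+-cancelˡ-≤ k {i} {j} le = subst₂ _≤_ (cancel k i) (cancel k j) (ℤ.+-monoʳ-≤ (- k) le)
  where
  cancel : ∀ k i → - k + (k + i) ≡ i
  cancel = solve-∀

+-cancelʳ-≤ : ∀ k {i j} → i + k ≤ j + k → i ≤ j
+-cancelʳ-≤ k {i} {j} le = +-cancelˡ-≤ k (subst₂ _≤_ (ℤ.+-comm i k) (ℤ.+-comm j k) le)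

+-cancelʳ-< : ∀ k {i j} → i + k < j + k → i < j
+-cancelʳ-< k {i} {j} lt = subst₂ _<_ (cancel i k) (cancel j k) (ℤ.+-monoˡ-< (- k) lt)
  where
  cancel : ∀ i k → i + k - k ≡ i
  cancel = solve-∀

<+1⇒≤ : ∀ {i j} → i < j + 1ℤ → i ≤ j
<+1⇒≤ {i} {j} i<j+1 = subst (i ≤_) (pred-+1 j) (ℤ.i<j⇒i≤pred[j] i<j+1)
  where
  pred-+1 : ∀ j → -1ℤ + (j + 1ℤ) ≡ j
  pred-+1 = solve-∀

<-<⇒+2≤ : ∀ {i j k} → i < j → j < k → i + + 2 ≤ k
<-<⇒+2≤ {i} i<j j<k =
  subst (_≤ _) (suc-suc i) (ℤ.≤-trans (ℤ.suc-mono (ℤ.i<j⇒suc[i]≤j i<j)) (ℤ.i<j⇒suc[i]≤j j<k))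
  where
  suc-suc : ∀ i → 1ℤ + (1ℤ + i) ≡ i + + 2
  suc-suc = solve-∀

+2≤⇒+1≤-1 : ∀ {i j} → i + + 2 ≤ j → i + 1ℤ ≤ j - 1ℤ
+2≤⇒+1≤-1 {i} gap = subst (_≤ _) (lower i) (ℤ.+-monoˡ-≤ (- 1ℤ) gap)
  where
  lower : ∀ i → i + + 2 - 1ℤ ≡ i + 1ℤ
  lower = solve-∀

+-squeeze : ∀ {p a q c} → p ≤ a → q ≤ c → a + c ≤ p + q → p ≡ a × q ≡ c
+-squeeze {p} {a} {q} {c} p≤a q≤c sum≤ =
    ℤ.≤-antisym p≤a (+-cancelʳ-≤ c (ℤ.≤-trans sum≤ (ℤ.+-monoʳ-≤ p q≤c)))
  , ℤ.≤-antisym q≤c (+-cancelˡ-≤ a (ℤ.≤-trans sum≤ (ℤ.+-monoˡ-≤ q p≤a)))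

≤-≤∞-trans : ∀ {a c x} → a ≤ c → fin c ≤∞ x → fin a ≤∞ x
≤-≤∞-trans a≤c (fin≤fin c≤d) = fin≤fin (ℤ.≤-trans a≤c c≤d)
≤-≤∞-trans a≤c (_ ≤∞top)     = _ ≤∞top

fin-injective : ∀ {a c} → fin a ≡ fin c → a ≡ c
fin-injective refl = refl

infix 8 _⁺

_⁺ : ℤ → ℤ
i ⁺ = i ⊔ 0ℤ

⁺-nonneg : ∀ v r → 0ℤ ≤ (v - r) ⁺
⁺-nonneg v r = ℤ.i≤j⊔i (v - r) 0ℤ

⁺-≥ : ∀ v r → v - r ≤ (v - r) ⁺
⁺-≥ v r = ℤ.i≤i⊔j (v - r) 0ℤ

⁺-zero : ∀ {v r} → v ≤ r → (v - r) ⁺ ≡ 0ℤ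
⁺-zero v≤r = ℤ.i≤j⇒i⊔j≡j (ℤ.i≤j⇒i-j≤0 v≤r)

⁺-exact : ∀ {v r} → r ≤ v → (v - r) ⁺ ≡ v - r
⁺-exact r≤v = ℤ.i≥j⇒i⊔j≡i (ℤ.i≤j⇒0≤j-i r≤v)

⁺-pos : ∀ {v r} → r < v → 0ℤ < (v - r) ⁺
⁺-pos {v} {r} r<v =
  ℤ.<-≤-trans (subst (_< v - r) (ℤ.+-inverseʳ r) (ℤ.+-monoˡ-< (- r) r<v)) (⁺-≥ v r)

⁺-monoˡ : ∀ r {v w} → v ≤ w → (v - r) ⁺ ≤ (w - r) ⁺
⁺-monoˡ r v≤w = ℤ.⊔-monoˡ-≤ 0ℤ (ℤ.+-monoˡ-≤ (- r) v≤w)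

⁺-flip : ∀ v r → (r - v) ⁺ + v ≡ (v - r) ⁺ + r
⁺-flip v r = Sum.[ v≤r-case , r≤v-case ]′ (ℤ.≤-total v r)
  where
  open ≡-Reasoning
  shift : ∀ a b → a - b + b ≡ 0ℤ + a
  shift = solve-∀
  v≤r-case : v ≤ r → (r - v) ⁺ + v ≡ (v - r) ⁺ + r
  v≤r-case v≤r = begin
    (r - v) ⁺ + v ≡⟨ cong (_+ v) (⁺-exact v≤r) ⟩
    r - v + v     ≡⟨ shift r v ⟩
    0ℤ + r        ≡⟨ cong (_+ r) (⁺-zero v≤r) ⟨
    (v - r) ⁺ + r ∎
  r≤v-case : r ≤ v → (r - v) ⁺ + v ≡ (v - r) ⁺ + r
  r≤v-case r≤v = begin
    (r - v) ⁺ + v ≡⟨ cong (_+ v) (⁺-zero r≤v) ⟩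
    0ℤ + v        ≡⟨ shift v r ⟨
    v - r + r     ≡⟨ cong (_+ r) (⁺-exact r≤v) ⟨
    (v - r) ⁺ + r ∎

∑-cong : ∀ {n} {f g : Fin n → ℤ} → (∀ i → f i ≡ g i) → ∑ f ≡ ∑ g
∑-cong {zero}  f≗g = refl
∑-cong {suc n} f≗g = cong₂ _+_ (f≗g zero) (∑-cong (f≗g ∘ suc))

∑-mono : ∀ {n} {f g : Fin n → ℤ} → (∀ i → f i ≤ g i) → ∑ f ≤ ∑ g
∑-mono {zero}  f≤g = ℤ.≤-refl
∑-mono {suc n} f≤g = ℤ.+-mono-≤ (f≤g zero) (∑-mono (f≤g ∘ suc))

∑-+ : ∀ {n} (f g : Fin n → ℤ) → ∑ (λ i → f i + g i) ≡ ∑ f + ∑ g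
∑-+ {zero}  f g = refl
∑-+ {suc n} f g = trans (cong (_+_ (f zero + g zero)) (∑-+ (f ∘ suc) (g ∘ suc)))
  (interchange (f zero) (g zero) _ _)
  where
  interchange : ∀ a b c d → a + b + (c + d) ≡ a + c + (b + d)
  interchange = solve-∀

∑-neg : ∀ {n} (f : Fin n → ℤ) → ∑ (λ i → - f i) ≡ - ∑ f
∑-neg {zero}  f = refl
∑-neg {suc n} f = trans (cong (_+_ (- f zero)) (∑-neg (f ∘ suc))) (sym (ℤ.neg-distrib-+ (f zero) _))

∑-- : ∀ {n} (f g : Fin n → ℤ) → ∑ (λ i → f i - g i) ≡ ∑ f - ∑ g
∑-- f g = trans (∑-+ f (λ i → - g i)) (cong (_+_ (∑ f)) (∑-neg g))

∑-zero : ∀ {n} {f : Fin n → ℤ} → (∀ i → f i ≡ 0ℤ) → ∑ f ≡ 0ℤ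
∑-zero {zero}  f≡0 = refl
∑-zero {suc n} f≡0 = cong₂ _+_ (f≡0 zero) (∑-zero (f≡0 ∘ suc))

∑-point : ∀ {n} (f : Fin n → ℤ) s → (∀ i → i ≢ s → f i ≡ 0ℤ) → ∑ f ≡ f s
∑-point f zero    off = trans (cong (_+_ (f zero)) (∑-zero (λ i → off (suc i) λ ()))) (ℤ.+-identityʳ _)
∑-point f (suc s) off = trans (cong (_+ ∑ (f ∘ suc)) (off zero λ ()))
  (trans (ℤ.+-identityˡ _) (∑-point (f ∘ suc) s (λ i i≢s → off (suc i) (i≢s ∘ Fin.suc-injective))))

∑-pair : ∀ {n} (f : Fin n → ℤ) s t → s ≢ t → (∀ i → i ≢ s → i ≢ t → f i ≡ 0ℤ) →
  ∑ f ≡ f s + f t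
∑-pair f zero    zero    s≢t off = ⊥-elim (s≢t refl)
∑-pair f zero    (suc t) s≢t off =
  cong (_+_ (f zero)) (∑-point (f ∘ suc) t (λ i i≢t → off (suc i) (λ ()) (i≢t ∘ Fin.suc-injective)))
∑-pair f (suc s) zero    s≢t off = trans
  (cong (_+_ (f zero)) (∑-point (f ∘ suc) s (λ i i≢s → off (suc i) (i≢s ∘ Fin.suc-injective) (λ ()))))
  (ℤ.+-comm (f zero) (f (suc s)))
∑-pair f (suc s) (suc t) s≢t off = trans (cong (_+ ∑ (f ∘ suc)) (off zero (λ ()) (λ ())))
  (trans (ℤ.+-identityˡ _) (∑-pair (f ∘ suc) s t (s≢t ∘ cong suc)
    (λ i i≢s i≢t → off (suc i) (i≢s ∘ Fin.suc-injective) (i≢t ∘ Fin.suc-injective))))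

∑-change₂ : ∀ {n} (f g : Fin n → ℤ) {s t} → s ≢ t → (∀ i → i ≢ s → i ≢ t → f i ≡ g i) →
  ∑ f + (g s + g t) ≡ ∑ g + (f s + f t)
∑-change₂ f g {s} {t} s≢t agree = begin
  ∑ f + (g s + g t)                             ≡⟨ regroup (∑ f) (∑ g) (g s) (g t) ⟩
  (∑ f - ∑ g) + ∑ g + (g s + g t)               ≡⟨ cong (λ d → d + ∑ g + (g s + g t)) ∑f-∑g ⟩
  (f s - g s + (f t - g t)) + ∑ g + (g s + g t) ≡⟨ cancel (f s) (g s) (f t) (g t) (∑ g) ⟩
  ∑ g + (f s + f t)                             ∎
  where
  open ≡-Reasoning
  regroup : ∀ F G a b → F + (a + b) ≡ (F - G) + G + (a + b)
  regroup = solve-∀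
  cancel : ∀ p a q b G → (p - a + (q - b)) + G + (a + b) ≡ G + (p + q)
  cancel = solve-∀
  ∑f-∑g : ∑ f - ∑ g ≡ f s - g s + (f t - g t)
  ∑f-∑g = trans (sym (∑-- f g)) (∑-pair (λ i → f i - g i) s t s≢t
    (λ i i≢s i≢t → trans (cong (_- g i) (agree i i≢s i≢t)) (ℤ.+-inverseʳ (g i))))

x∈p─q⇒x∉q : ∀ {n} {x : Fin n} (p q : Subset n) → x ∈ p ─ q → x ∉ q
x∈p─q⇒x∉q {x = zero}  (_ ∷ p) (true ∷ q)  ()
x∈p─q⇒x∉q {x = zero}  (_ ∷ p) (false ∷ q) _          ()
x∈p─q⇒x∉q {x = suc x} (_ ∷ p) (_ ∷ q)     (there x∈) (there x∈q) = x∈p─q⇒x∉q p q x∈ x∈q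

∁-involutive : ∀ {n} (p : Subset n) → ∁ (∁ p) ≡ p
∁-involutive []      = refl
∁-involutive (x ∷ p) = cong₂ _∷_ (not-involutive x) (∁-involutive p)

⊂⊤⊎≡⊤ : ∀ {n} (Z : Subset n) → Z ⊂ ⊤ ⊎ Z ≡ ⊤
⊂⊤⊎≡⊤ Z with Fin.any? (λ u → ¬? (u ∈? Z))
... | yes (u , u∉Z) = inj₁ (⊆⊤ , u , ∈⊤ , u∉Z)
... | no  ∄u∉Z     = inj₂ (⊆-antisym ⊆⊤ λ {u} _ → decidable-stable (u ∈? Z) (∄u∉Z ∘ (u ,_)))

-- tilde x X is definitionally ∑ (select X x).
select : ∀ {n} → Subset n → (Fin n → ℤ) → Fin n → ℤ
select X x i = if lookup X i then x i else 0ℤ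

select-∈ : ∀ {n} {X : Subset n} {i} (x : Fin n → ℤ) → i ∈ X → select X x i ≡ x i
select-∈ {X = X} {i} x i∈X rewrite Vec.[]=⇒lookup i∈X = refl

select-∉ : ∀ {n} {X : Subset n} {i} (x : Fin n → ℤ) → i ∉ X → select X x i ≡ 0ℤ
select-∉ {X = X} {i} x i∉X with lookup X i in eq
... | true  = ⊥-elim (i∉X (Vec.lookup⇒[]= i X eq))
... | false = refl

tilde-+ : ∀ {n} (x y : Fin n → ℤ) X → tilde (λ i → x i + y i) X ≡ tilde x X + tilde y X
tilde-+ x y X = trans (∑-cong pointwise) (∑-+ (select X x) (select X y))
  where
  pointwise : ∀ i → select X (λ j → x j + y j) i ≡ select X x i + select X y i
  pointwise i with lookup X i
  ... | true  = refl
  ... | false = refl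

tilde-- : ∀ {n} (x y : Fin n → ℤ) X → tilde (λ i → x i - y i) X ≡ tilde x X - tilde y X
tilde-- x y X = trans (∑-cong pointwise) (∑-- (select X x) (select X y))
  where
  pointwise : ∀ i → select X (λ j → x j - y j) i ≡ select X x i - select X y i
  pointwise i with lookup X i
  ... | true  = refl
  ... | false = refl

tilde-⊤ : ∀ {n} (x : Fin n → ℤ) → tilde x ⊤ ≡ ∑ x
tilde-⊤ x = ∑-cong (λ i → select-∈ {i = i} x ∈⊤)

tilde-⊥ : ∀ {n} (x : Fin n → ℤ) → tilde x ⊥ ≡ 0ℤ
tilde-⊥ x = ∑-zero (λ i → select-∉ {i = i} x ∉⊥)

tilde-∩∪ : ∀ {n} (x : Fin n → ℤ) X Y → tilde x (X ∩ Y) + tilde x (X ∪ Y) ≡ tilde x X + tilde x Y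
tilde-∩∪ x X Y = begin
  tilde x (X ∩ Y) + tilde x (X ∪ Y)                 ≡⟨ ∑-+ (select (X ∩ Y) x) (select (X ∪ Y) x) ⟨
  ∑ (λ i → select (X ∩ Y) x i + select (X ∪ Y) x i) ≡⟨ ∑-cong pointwise ⟩
  ∑ (λ i → select X x i + select Y x i)             ≡⟨ ∑-+ (select X x) (select Y x) ⟩
  tilde x X + tilde x Y                             ∎
  where
  open ≡-Reasoning
  pointwise : ∀ i → select (X ∩ Y) x i + select (X ∪ Y) x i ≡ select X x i + select Y x i
  pointwise i rewrite Vec.lookup-zipWith _∧_ i X Y | Vec.lookup-zipWith _∨_ i X Y
    with lookup X i | lookup Y i
  ... | true  | true  = refl
  ... | true  | false = ℤ.+-comm 0ℤ (x i)
  ... | false | _     = refl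

tilde-∁ : ∀ {n} (x : Fin n → ℤ) X → tilde x X + tilde x (∁ X) ≡ ∑ x
tilde-∁ x X = trans (sym (∑-+ (select X x) (select (∁ X) x))) (∑-cong pointwise)
  where
  pointwise : ∀ i → select X x i + select (∁ X) x i ≡ x i
  pointwise i rewrite Vec.lookup-map i not X with lookup X i
  ... | true  = ℤ.+-identityʳ (x i)
  ... | false = ℤ.+-identityˡ (x i)

χ-self : ∀ {n} (s : Fin n) → χ s s ≡ 1ℤ
χ-self s with s Fin.≟ s
... | yes _   = refl
... | no  s≢s = ⊥-elim (s≢s refl)

χ-other : ∀ {n} {s u : Fin n} → u ≢ s → χ s u ≡ 0ℤ
χ-other {s = s} {u} u≢s with s Fin.≟ u
... | yes s≡u = ⊥-elim (u≢s (sym s≡u))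
... | no  _   = refl

tilde-χ : ∀ {n} (s : Fin n) X → tilde (χ s) X ≡ select X (χ s) s
tilde-χ s X = ∑-point (select X (χ s)) s off
  where
  off : ∀ i → i ≢ s → select X (χ s) i ≡ 0ℤ
  off i i≢s with lookup X i
  ... | true  = χ-other i≢s
  ... | false = refl

tilde-χ-∈ : ∀ {n} {s : Fin n} {X} → s ∈ X → tilde (χ s) X ≡ 1ℤ
tilde-χ-∈ {s = s} {X} s∈X = trans (tilde-χ s X) (trans (select-∈ (χ s) s∈X) (χ-self s))

tilde-χ-∉ : ∀ {n} {s : Fin n} {X} → s ∉ X → tilde (χ s) X ≡ 0ℤ
tilde-χ-∉ {s = s} {X} s∉X = trans (tilde-χ s X) (select-∉ (χ s) s∉X)

-- The base polyhedron

module BasePolyhedron {n} (b : SetFn n) where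

  tilde≤b : ∀ {y} → InB b y → ∀ {Z c} → b Z ≡ fin c → tilde y Z ≤ c
  tilde≤b (y⊤ , yZ) {Z} bZ with ⊂⊤⊎≡⊤ Z
  ... | inj₁ Z⊂⊤ with fin≤fin ỹZ≤c ← subst (fin (tilde _ Z) ≤∞_) bZ (yZ Z Z⊂⊤) = ỹZ≤c
  ... | inj₂ refl = ℤ.≤-reflexive (fin-injective (trans (sym y⊤) bZ))

  ∑-InB : ∀ {x y} → InB b x → InB b y → ∑ x ≡ ∑ y
  ∑-InB {x} {y} (x⊤ , _) (y⊤ , _) = begin
    ∑ x       ≡⟨ tilde-⊤ x ⟨
    tilde x ⊤ ≡⟨ fin-injective (trans (sym x⊤) y⊤) ⟩
    tilde y ⊤ ≡⟨ tilde-⊤ y ⟩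
    ∑ y       ∎
    where open ≡-Reasoning

  compl≡just : ∀ {X v} → compl b X ≡ just v →
    ∃ λ bS → ∃ λ c → b ⊤ ≡ fin bS × b (∁ X) ≡ fin c × bS - c ≡ v
  compl≡just {X} eq with b ⊤ | b (∁ X)
  compl≡just refl | fin bS | fin c = bS , c , refl , refl , refl

  compl-fin : ∀ {X bS c} → b ⊤ ≡ fin bS → b (∁ X) ≡ fin c → compl b X ≡ just (bS - c)
  compl-fin {X} b⊤ b∁X rewrite b⊤ | b∁X = refl

  tightP⇒tilde≤ : ∀ {m y X} → InB b y → TightP b m X → tilde m X ≤ tilde y X
  tightP⇒tilde≤ {m} {y} {X} y∈B tight with compl≡just tight
  ... | bS , c , b⊤ , b∁X , bS-c≡m̃X = begin
    tilde m X                                 ≡⟨ bS-c≡m̃X ⟨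
    bS - c                                    ≤⟨ ℤ.+-monoʳ-≤ bS (ℤ.neg-mono-≤ (tilde≤b y∈B b∁X)) ⟩
    bS - tilde y (∁ X)                        ≡⟨ cong (_- tilde y (∁ X)) bS≡ ⟩
    tilde y X + tilde y (∁ X) - tilde y (∁ X) ≡⟨ cancel (tilde y X) (tilde y (∁ X)) ⟩
    tilde y X                                 ∎
    where
    open ℤ.≤-Reasoning
    cancel : ∀ a d → a + d - d ≡ a
    cancel = solve-∀
    bS≡ : bS ≡ tilde y X + tilde y (∁ X)
    bS≡ = trans (fin-injective (trans (sym b⊤) (proj₁ y∈B))) (trans (tilde-⊤ y) (sym (tilde-∁ y X)))

-- Threshold sums and the decreasing and increasing orders

excess : ∀ {n} → (Fin n → ℤ) → ℤ → ℤ
excess x r = ∑ (λ i → (x i - r) ⁺)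

deficit : ∀ {n} → (Fin n → ℤ) → ℤ → ℤ
deficit x r = ∑ (λ i → (r - x i) ⁺)

deficit+∑ : ∀ {n} (x : Fin n → ℤ) r → deficit x r + ∑ x ≡ excess x r + ∑ {n} (λ _ → r)
deficit+∑ {n} x r = begin
  deficit x r + ∑ x            ≡⟨ ∑-+ (λ i → (r - x i) ⁺) x ⟨
  ∑ (λ i → (r - x i) ⁺ + x i)  ≡⟨ ∑-cong (λ i → ⁺-flip (x i) r) ⟩
  ∑ (λ i → (x i - r) ⁺ + r)    ≡⟨ ∑-+ (λ i → (x i - r) ⁺) (λ _ → r) ⟩
  excess x r + ∑ {n} (λ _ → r) ∎
  where open ≡-Reasoning

deficit-≤ : ∀ {n} {x y : Fin n → ℤ} r → ∑ x ≡ ∑ y → excess x r ≤ excess y r →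
  deficit x r ≤ deficit y r
deficit-≤ {n} {x} {y} r ∑x≡∑y le = +-cancelʳ-≤ (∑ x) (begin
  deficit x r + ∑ x            ≡⟨ deficit+∑ x r ⟩
  excess x r + ∑ {n} (λ _ → r) ≤⟨ ℤ.+-monoˡ-≤ (∑ {n} (λ _ → r)) le ⟩
  excess y r + ∑ {n} (λ _ → r) ≡⟨ deficit+∑ y r ⟨
  deficit y r + ∑ y            ≡⟨ cong (_+_ (deficit y r)) ∑x≡∑y ⟨
  deficit y r + ∑ x            ∎)
  where open ℤ.≤-Reasoning

sumMap : (ℤ → ℤ) → List ℤ → ℤ
sumMap g xs = foldr _+_ 0ℤ (map g xs)

sumMap-↭ : ∀ g {xs ys} → xs ↭ ys → sumMap g xs ≡ sumMap g ys
sumMap-↭ g p = ↭ₛ.foldr-commMonoid ℤ.+-0-isCommutativeMonoid (↭⇒↭ₛ (↭.map⁺ g p))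
  where import Data.List.Relation.Binary.Permutation.Setoid.Properties (setoid ℤ) as ↭ₛ

sumMap-toList : ∀ {n} g (x : Fin n → ℤ) → sumMap g (toList x) ≡ ∑ (g ∘ x)
sumMap-toList {zero}  g x = refl
sumMap-toList {suc n} g x = cong (_+_ (g (x zero))) (sumMap-toList g (x ∘ suc))

sumMap-nonneg : ∀ {g} → (∀ v → 0ℤ ≤ g v) → ∀ xs → 0ℤ ≤ sumMap g xs
sumMap-nonneg g≥0 []       = ℤ.≤-refl
sumMap-nonneg g≥0 (x ∷ xs) = ℤ.+-mono-≤ (g≥0 x) (sumMap-nonneg g≥0 xs)

sumMap-zero : ∀ {g xs} → All (λ v → g v ≡ 0ℤ) xs → sumMap g xs ≡ 0ℤ
sumMap-zero []           = refl
sumMap-zero (gx≡0 ∷ gxs) = cong₂ _+_ gx≡0 (sumMap-zero gxs)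

lex-irrefl : ∀ {xs} → ¬ LexLess xs xs
lex-irrefl (here x<x)    = ℤ.<-irrefl refl x<x
lex-irrefl (there xs<xs) = lex-irrefl xs<xs

lex-asym : ∀ {xs ys} → LexLess xs ys → ¬ LexLess ys xs
lex-asym (here x<y)    (here y<x)    = ℤ.<-asym x<y y<x
lex-asym (here x<x)    (there _)     = ℤ.<-irrefl refl x<x
lex-asym (there _)     (here x<x)    = ℤ.<-irrefl refl x<x
lex-asym (there xs<ys) (there ys<xs) = lex-asym xs<ys ys<xs

-- At the first difference, the threshold r = b₀ separates the two sorted lists.
lex-from-excess : ∀ {a b} → length a ≡ length b → AllPairs (flip _≤_) a → AllPairs (flip _≤_) b →
  (∀ r → sumMap (λ v → (v - r) ⁺) a ≤ sumMap (λ v → (v - r) ⁺) b) → LexLess a b ⊎ a ≡ b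
lex-from-excess {[]}     {[]}     _   _        _           _   = inj₂ refl
lex-from-excess {a₀ ∷ a} {b₀ ∷ b} len (_ ∷ a↓) (b₀≥b ∷ b↓) dom with ℤ.<-cmp a₀ b₀
... | tri< a₀<b₀ _ _ = inj₁ (here a₀<b₀)
... | tri≈ _ refl _  = Sum.map there (cong (a₀ ∷_))
  (lex-from-excess (ℕ.suc-injective len) a↓ b↓ (λ r → +-cancelˡ-≤ ((a₀ - r) ⁺) (dom r)))
... | tri> _ _ b₀<a₀ = ⊥-elim (ℤ.<⇒≱ excess-a>0 (subst (_ ≤_) excess-b≡0 (dom b₀)))
  where
  excess-a>0 : 0ℤ < sumMap (λ v → (v - b₀) ⁺) (a₀ ∷ a)
  excess-a>0 = ℤ.+-mono-<-≤ (⁺-pos b₀<a₀) (sumMap-nonneg (λ v → ⁺-nonneg v b₀) a)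
  excess-b≡0 : sumMap (λ v → (v - b₀) ⁺) (b₀ ∷ b) ≡ 0ℤ
  excess-b≡0 = sumMap-zero {xs = b₀ ∷ b} (⁺-zero (ℤ.≤-refl {b₀}) ∷ All.map ⁺-zero b₀≥b)

lex-from-deficit : ∀ {a b} → length a ≡ length b → AllPairs _≤_ a → AllPairs _≤_ b →
  (∀ r → sumMap (λ v → (r - v) ⁺) a ≤ sumMap (λ v → (r - v) ⁺) b) → LexLess b a ⊎ a ≡ b
lex-from-deficit {[]}     {[]}     _   _        _           _   = inj₂ refl
lex-from-deficit {a₀ ∷ a} {b₀ ∷ b} len (_ ∷ a↑) (b₀≤b ∷ b↑) dom with ℤ.<-cmp a₀ b₀
... | tri> _ _ b₀<a₀ = inj₁ (here b₀<a₀)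
... | tri≈ _ refl _  = Sum.map there (cong (a₀ ∷_))
  (lex-from-deficit (ℕ.suc-injective len) a↑ b↑ (λ r → +-cancelˡ-≤ ((r - a₀) ⁺) (dom r)))
... | tri< a₀<b₀ _ _ = ⊥-elim (ℤ.<⇒≱ deficit-a>0 (subst (_ ≤_) deficit-b≡0 (dom b₀)))
  where
  deficit-a>0 : 0ℤ < sumMap (λ v → (b₀ - v) ⁺) (a₀ ∷ a)
  deficit-a>0 = ℤ.+-mono-<-≤ (⁺-pos a₀<b₀) (sumMap-nonneg (λ v → ⁺-nonneg b₀ v) a)
  deficit-b≡0 : sumMap (λ v → (b₀ - v) ⁺) (b₀ ∷ b) ≡ 0ℤ
  deficit-b≡0 = sumMap-zero {xs = b₀ ∷ b} (⁺-zero (ℤ.≤-refl {b₀}) ∷ All.map ⁺-zero b₀≤b)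

AllPairs-reverse : ∀ {R : ℤ → ℤ → Set} {xs} → AllPairs R xs → AllPairs (flip R) (reverse xs)
AllPairs-reverse {xs = []}     []         = []
AllPairs-reverse {xs = x ∷ xs} (Rx ∷ Rxs) = subst (AllPairs _) (sym (List.unfold-reverse x xs))
  (AllPairs.++⁺ (AllPairs-reverse Rxs) ([] ∷ [])
    (All.map (_∷ []) (↭.All-resp-↭ (↭-sym (↭.↭-reverse xs)) Rx)))

module _ {n} (x : Fin n → ℤ) where

  ↑-sorted : AllPairs _≤_ (x ↑)
  ↑-sorted = Linked.Linked⇒AllPairs ℤ.≤-trans (Sort.sort-↗ (toList x))

  ↓-sorted : AllPairs (flip _≤_) (x ↓)
  ↓-sorted = AllPairs-reverse ↑-sorted

  ↑-↭ : x ↑ ↭ toList x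
  ↑-↭ = Sort.sort-↭ (toList x)

  ↓-↭ : x ↓ ↭ toList x
  ↓-↭ = ↭-trans (↭.↭-reverse (x ↑)) ↑-↭

  length-↑ : length (x ↑) ≡ n
  length-↑ = trans (↭.↭-length ↑-↭) (List.length-tabulate x)

  length-↓ : length (x ↓) ≡ n
  length-↓ = trans (↭.↭-length ↓-↭) (List.length-tabulate x)

  excess-↓ : ∀ r → sumMap (λ v → (v - r) ⁺) (x ↓) ≡ excess x r
  excess-↓ r = trans (sumMap-↭ _ ↓-↭) (sumMap-toList _ x)

  deficit-↑ : ∀ r → sumMap (λ v → (r - v) ⁺) (x ↑) ≡ deficit x r
  deficit-↑ r = trans (sumMap-↭ _ ↑-↭) (sumMap-toList _ x)

module _ {n} {x y : Fin n → ℤ} where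

  ≤dec-from-excess : (∀ r → excess x r ≤ excess y r) → x ≤dec y
  ≤dec-from-excess dom =
    lex-from-excess (trans (length-↓ x) (sym (length-↓ y))) (↓-sorted x) (↓-sorted y)
      (λ r → subst₂ _≤_ (sym (excess-↓ x r)) (sym (excess-↓ y r)) (dom r))

  ≥inc-from-deficit : (∀ r → deficit x r ≤ deficit y r) → x ≥inc y
  ≥inc-from-deficit dom =
    lex-from-deficit (trans (length-↑ x) (sym (length-↑ y))) (↑-sorted x) (↑-sorted y)
      (λ r → subst₂ _≤_ (sym (deficit-↑ x r)) (sym (deficit-↑ y r)) (dom r))

  ≤dec-antisym : x ≤dec y → y ≤dec x → x ↓ ≡ y ↓
  ≤dec-antisym (inj₂ x↓≡y↓) _            = x↓≡y↓
  ≤dec-antisym (inj₁ x<y)   (inj₁ y<x)   = ⊥-elim (lex-asym x<y y<x)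
  ≤dec-antisym (inj₁ x<y)   (inj₂ y↓≡x↓) = ⊥-elim (lex-irrefl (subst (LexLess _) y↓≡x↓ x<y))

  ≥inc-antisym : x ≥inc y → y ≥inc x → x ↑ ≡ y ↑
  ≥inc-antisym (inj₂ x↑≡y↑) _            = x↑≡y↑
  ≥inc-antisym (inj₁ x>y)   (inj₁ y>x)   = ⊥-elim (lex-asym x>y y>x)
  ≥inc-antisym (inj₁ x>y)   (inj₂ y↑≡x↑) = ⊥-elim (lex-irrefl (subst (λ l → LexLess l (x ↑)) y↑≡x↑ x>y))

  excess-cong : x ↓ ≡ y ↓ → ∀ r → excess x r ≡ excess y r
  excess-cong x↓≡y↓ r = trans (sym (excess-↓ x r)) (trans (cong (sumMap _) x↓≡y↓) (excess-↓ y r))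

-- Tightening steps

⁺-transfer : ∀ {a c} r → a + + 2 ≤ c → (a + 1ℤ - r) ⁺ + (c - 1ℤ - r) ⁺ ≤ (a - r) ⁺ + (c - r) ⁺
⁺-transfer {a} {c} r gap with r ℤ.≤? a
... | yes r≤a = ℤ.≤-reflexive (begin
  (a + 1ℤ - r) ⁺ + (c - 1ℤ - r) ⁺ ≡⟨ cong₂ _+_ (⁺-exact r≤a+1) (⁺-exact r≤c-1) ⟩
  (a + 1ℤ - r) + (c - 1ℤ - r)     ≡⟨ shuffle a c r ⟩
  (a - r) + (c - r)               ≡⟨ cong₂ _+_ (⁺-exact r≤a) (⁺-exact (ℤ.≤-trans r≤c-1 (ℤ.i-j≤i c 1ℤ))) ⟨
  (a - r) ⁺ + (c - r) ⁺           ∎)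
  where
  open ≡-Reasoning
  r≤a+1 = ℤ.≤-trans r≤a (ℤ.i≤i+j a 1ℤ)
  r≤c-1 = ℤ.≤-trans r≤a+1 (+2≤⇒+1≤-1 {a} gap)
  shuffle : ∀ a c r → (a + 1ℤ - r) + (c - 1ℤ - r) ≡ (a - r) + (c - r)
  shuffle = solve-∀
... | no r≰a = ℤ.+-mono-≤
  (ℤ.≤-reflexive (trans (⁺-zero a+1≤r) (sym (⁺-zero (ℤ.≤-trans (ℤ.i≤i+j a 1ℤ) a+1≤r)))))
  (⁺-monoˡ r (ℤ.i-j≤i c 1ℤ))
  where
  a+1≤r : a + 1ℤ ≤ r
  a+1≤r = subst (_≤ r) (ℤ.+-comm 1ℤ a) (ℤ.i<j⇒suc[i]≤j (ℤ.≰⇒> r≰a))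

⁺-transfer-strict : ∀ {a c} → a + + 2 ≤ c →
  (a + 1ℤ - (a + 1ℤ)) ⁺ + (c - 1ℤ - (a + 1ℤ)) ⁺ < (a - (a + 1ℤ)) ⁺ + (c - (a + 1ℤ)) ⁺
⁺-transfer-strict {a} {c} gap = ℤ.suc[i]≤j⇒i<j (ℤ.≤-reflexive (begin
  sucℤ ((a + 1ℤ - (a + 1ℤ)) ⁺ + (c - 1ℤ - (a + 1ℤ)) ⁺)
    ≡⟨ cong sucℤ (cong₂ _+_ (⁺-zero (ℤ.≤-refl {a + 1ℤ})) (⁺-exact a+1≤c-1)) ⟩
  sucℤ (0ℤ + (c - 1ℤ - (a + 1ℤ)))
    ≡⟨ shift a c ⟩
  0ℤ + (c - (a + 1ℤ))
    ≡⟨ cong₂ _+_ (⁺-zero (ℤ.i≤i+j a 1ℤ)) (⁺-exact (ℤ.≤-trans a+1≤c-1 (ℤ.i-j≤i c 1ℤ))) ⟨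
  (a - (a + 1ℤ)) ⁺ + (c - (a + 1ℤ)) ⁺
    ∎))
  where
  open ≡-Reasoning
  a+1≤c-1 = +2≤⇒+1≤-1 {a} gap
  shift : ∀ a c → 1ℤ + (0ℤ + (c - 1ℤ - (a + 1ℤ))) ≡ 0ℤ + (c - (a + 1ℤ))
  shift = solve-∀

module Transfer {n} (m : Fin n → ℤ) {s t : Fin n} (gap : m s + + 2 ≤ m t) where

  m′ : Fin n → ℤ
  m′ u = m u + χ s u - χ t u

  s≢t : s ≢ t
  s≢t refl = ℤ.<⇒≱ (ℤ.+-monoʳ-< (m s) (+<+ (ℕ.z<s {1})))
                    (subst (m s + + 2 ≤_) (sym (ℤ.+-identityʳ (m s))) gap)

  m′-s : m′ s ≡ m s + 1ℤ
  m′-s = trans (cong₂ (λ p q → m s + p - q) (χ-self s) (χ-other s≢t)) (ℤ.+-identityʳ (m s + 1ℤ))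

  m′-t : m′ t ≡ m t - 1ℤ
  m′-t = trans (cong₂ (λ p q → m t + p - q) (χ-other (s≢t ∘ sym)) (χ-self t))
    (cong (_- 1ℤ) (ℤ.+-identityʳ (m t)))

  m′-other : ∀ {u} → u ≢ s → u ≢ t → m′ u ≡ m u
  m′-other {u} u≢s u≢t = trans (cong₂ (λ p q → m u + p - q) (χ-other u≢s) (χ-other u≢t))
    (trans (ℤ.+-identityʳ (m u + 0ℤ)) (ℤ.+-identityʳ (m u)))

  tilde-m′ : ∀ X → tilde m′ X ≡ tilde m X + tilde (χ s) X - tilde (χ t) X
  tilde-m′ X = trans (tilde-- (λ u → m u + χ s u) (χ t) X) (cong (_- tilde (χ t) X) (tilde-+ m (χ s) X))

  ∑-m′ : ∑ m′ ≡ ∑ m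
  ∑-m′ = begin
    ∑ m′                                      ≡⟨ tilde-⊤ m′ ⟨
    tilde m′ ⊤                                ≡⟨ tilde-m′ ⊤ ⟩
    tilde m ⊤ + tilde (χ s) ⊤ - tilde (χ t) ⊤ ≡⟨ cong₂ (λ p q → tilde m ⊤ + p - q) (χ̃-⊤ s) (χ̃-⊤ t) ⟩
    tilde m ⊤ + 1ℤ - 1ℤ                       ≡⟨ cancel (tilde m ⊤) ⟩
    tilde m ⊤                                 ≡⟨ tilde-⊤ m ⟩
    ∑ m                                       ∎
    where
    open ≡-Reasoning
    χ̃-⊤ : ∀ u → tilde (χ u) ⊤ ≡ 1ℤ
    χ̃-⊤ u = tilde-χ-∈ {s = u} ∈⊤
    cancel : ∀ a → a + 1ℤ - 1ℤ ≡ a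
    cancel = solve-∀

  excess-m′ : ∀ r → excess m′ r + ((m s - r) ⁺ + (m t - r) ⁺)
                  ≡ excess m r + ((m s + 1ℤ - r) ⁺ + (m t - 1ℤ - r) ⁺)
  excess-m′ r = trans
    (∑-change₂ (λ i → (m′ i - r) ⁺) (λ i → (m i - r) ⁺) s≢t
      (λ i i≢s i≢t → cong (λ v → (v - r) ⁺) (m′-other i≢s i≢t)))
    (cong₂ (λ p q → excess m r + ((p - r) ⁺ + (q - r) ⁺)) m′-s m′-t)

  excess-m′≤ : ∀ r → excess m′ r ≤ excess m r
  excess-m′≤ r = +-cancelʳ-≤ ((m s - r) ⁺ + (m t - r) ⁺) (begin
    excess m′ r + ((m s - r) ⁺ + (m t - r) ⁺)          ≡⟨ excess-m′ r ⟩
    excess m r + ((m s + 1ℤ - r) ⁺ + (m t - 1ℤ - r) ⁺) ≤⟨ ℤ.+-monoʳ-≤ (excess m r) (⁺-transfer {m s} {m t} r gap) ⟩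
    excess m r + ((m s - r) ⁺ + (m t - r) ⁺)           ∎)
    where open ℤ.≤-Reasoning

  excess-m′< : excess m′ (m s + 1ℤ) < excess m (m s + 1ℤ)
  excess-m′< = +-cancelʳ-< ((m s - r) ⁺ + (m t - r) ⁺) (begin-strict
    excess m′ r + ((m s - r) ⁺ + (m t - r) ⁺)          ≡⟨ excess-m′ r ⟩
    excess m r + ((m s + 1ℤ - r) ⁺ + (m t - 1ℤ - r) ⁺) <⟨ ℤ.+-monoʳ-< (excess m r) (⁺-transfer-strict {m s} {m t} gap) ⟩
    excess m r + ((m s - r) ⁺ + (m t - r) ⁺)           ∎)
    where
    open ℤ.≤-Reasoning
    r = m s + 1ℤ

  m′↓≢m↓ : m′ ↓ ≢ m ↓
  m′↓≢m↓ eq = ℤ.<-irrefl (excess-cong eq (m s + 1ℤ)) excess-m′<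

  m≰dec-m′ : ¬ m ≤dec m′
  m≰dec-m′ m≤m′ = m′↓≢m↓ (≤dec-antisym (≤dec-from-excess excess-m′≤) m≤m′)

  m≱inc-m′ : ¬ m ≥inc m′
  m≱inc-m′ m≥m′ = m′↓≢m↓ (cong reverse (≥inc-antisym m′≥m m≥m′))
    where
    m′≥m : m′ ≥inc m
    m′≥m = ≥inc-from-deficit (λ r → deficit-≤ {x = m′} {m} r ∑-m′ (excess-m′≤ r))

module _ {n} {b : SetFn n} {m : Fin n → ℤ} where

  decMin⇒noStep : DecMin b m → NoTighteningStep b m
  decMin⇒noStep decMin s t (gap , m′∈B) = Transfer.m≰dec-m′ m gap (decMin _ m′∈B)

  incMax⇒noStep : IncMax b m → NoTighteningStep b m
  incMax⇒noStep incMax s t (gap , m′∈B) = Transfer.m≱inc-m′ m gap (incMax _ m′∈B)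

-- Chains of tight top sets dominate B

Threshold : ∀ {n} → (Fin n → ℤ) → ℤ → Subset n → Set
Threshold m r X = (∀ u → r < m u → u ∈ X) × (∀ u → u ∈ X → r ≤ m u)

module _ {n} {m : Fin n → ℤ} {r : ℤ} where

  excess-threshold : ∀ {X} → Threshold m r X → excess m r ≡ tilde m X - tilde (λ _ → r) X
  excess-threshold {X} (above⊆X , X⊆above) = trans (∑-cong pointwise) (tilde-- m (λ _ → r) X)
    where
    pointwise : ∀ i → (m i - r) ⁺ ≡ select X (λ j → m j - r) i
    pointwise i with i ∈? X
    ... | yes i∈X = trans (⁺-exact (X⊆above i i∈X)) (sym (select-∈ (λ j → m j - r) i∈X))
    ... | no  i∉X = trans (⁺-zero (ℤ.≮⇒≥ (i∉X ∘ above⊆X i))) (sym (select-∉ (λ j → m j - r) i∉X))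

  excess-≤-of-threshold : ∀ {X y} → Threshold m r X → tilde m X ≤ tilde y X → excess m r ≤ excess y r
  excess-≤-of-threshold {X} {y} thr m̃≤ỹ = begin
    excess m r                    ≡⟨ excess-threshold thr ⟩
    tilde m X - tilde (λ _ → r) X ≤⟨ ℤ.+-monoˡ-≤ (- tilde (λ _ → r) X) m̃≤ỹ ⟩
    tilde y X - tilde (λ _ → r) X ≡⟨ tilde-- y (λ _ → r) X ⟨
    tilde (λ i → y i - r) X       ≤⟨ ∑-mono pointwise ⟩
    excess y r                    ∎
    where
    open ℤ.≤-Reasoning
    pointwise : ∀ i → select X (λ j → y j - r) i ≤ (y i - r) ⁺
    pointwise i with lookup X i
    ... | true  = ⁺-≥ (y i) r
    ... | false = ⁺-nonneg (y i) r

  above-threshold : ∀ {P X w} → Top m P → NearUniformOn m (X ─ P) → w ∈ X → w ∉ P → r < m w →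
    ∀ u → u ∈ X → r ≤ m u
  above-threshold {P} {X} {w} topP nu w∈X w∉P r<mw u u∈X with u ∈? P
  ... | yes u∈P = ℤ.<⇒≤ (ℤ.<-≤-trans r<mw (topP u w u∈P w∉P))
  ... | no  u∉P = <+1⇒≤ (ℤ.<-≤-trans r<mw (nu w u (x∈p∧x∉q⇒x∈p─q w∈X w∉P) (x∈p∧x∉q⇒x∈p─q u∈X u∉P)))

  -- P is the chain set preceding C zero, and w ∉ P witnesses that P is not yet a threshold set.
  threshold-in-chain : ∀ k (C : Fin (suc k) → Subset n) {P} →
    Top m P → NearUniformOn m (C zero ─ P) → (∀ j → NearUniformOn m (part C (suc j))) →
    (∀ i → Top m (C i)) → C (fromℕ k) ≡ ⊤ →
    ∀ {w} → w ∉ P → r < m w → ∃ λ i → Threshold m r (C i)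
  threshold-in-chain zero C topP nu₀ nu top last {w} w∉P r<mw =
    zero , C₀-covers , above-threshold topP nu₀ (C₀-covers w r<mw) w∉P r<mw
    where
    C₀-covers : ∀ u → r < m u → u ∈ C zero
    C₀-covers u _ = subst (u ∈_) (sym last) ∈⊤
  threshold-in-chain (suc k) C topP nu₀ nu top last {w} w∉P r<mw
    with Fin.any? (λ u → (r ℤ.<? m u) ×-dec ¬? (u ∈? C zero))
  ... | yes (w′ , r<mw′ , w′∉C₀) = Product.map suc id
    (threshold-in-chain k (C ∘ suc) (top zero) (nu zero) (nu ∘ suc) (top ∘ suc) last w′∉C₀ r<mw′)
  ... | no ∄w′ = zero , C₀-covers , above-threshold topP nu₀ (C₀-covers w r<mw) w∉P r<mw
    where
    C₀-covers : ∀ u → r < m u → u ∈ C zero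
    C₀-covers u r<mu = decidable-stable (u ∈? C zero) (λ u∉C₀ → ∄w′ (u , r<mu , u∉C₀))

module _ {n} {b : SetFn n} {m : Fin n → ℤ} where
  open BasePolyhedron b

  excess-dominated : ChainCond b m → ∀ {y} → InB b y → ∀ r → excess m r ≤ excess y r
  excess-dominated (k , C , _ , _ , last , top , tight , nu) {y} y∈B r with Fin.any? (λ w → r ℤ.<? m w)
  ... | no ∄w = excess-≤-of-threshold {X = ⊥}
    ((λ u r<mu → ⊥-elim (∄w (u , r<mu))) , (λ u u∈⊥ → ⊥-elim (∉⊥ u∈⊥)))
    (ℤ.≤-reflexive (trans (tilde-⊥ m) (sym (tilde-⊥ y))))
  ... | yes (w , r<mw) with threshold-in-chain k C (λ u _ u∈⊥ → ⊥-elim (∉⊥ u∈⊥))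
                              (subst (NearUniformOn m) (sym (p─⊥≡p (C zero))) (nu zero))
                              (nu ∘ suc) top last ∉⊥ r<mw
  ... | i , thr = excess-≤-of-threshold thr (tightP⇒tilde≤ y∈B (tight i))

  chain⇒decMin : ChainCond b m → DecMin b m
  chain⇒decMin chain y y∈B = ≤dec-from-excess (excess-dominated chain y∈B)

  chain⇒incMax : InB b m → ChainCond b m → IncMax b m
  chain⇒incMax m∈B chain y y∈B = ≥inc-from-deficit λ r →
    deficit-≤ {x = m} {y} r (∑-InB m∈B y∈B) (excess-dominated chain y∈B r)

-- Chains from tight sets

argmax-in : ∀ {n} (m : Fin n → ℤ) {D : Subset n} → Nonempty D →
  ∃ λ v → v ∈ D × ∀ {u} → u ∈ D → m u ≤ m v
argmax-in m {D} (v₀ , v₀∈D) =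
    argmax m v₀ Ds
  , argmax-all m v₀∈D (All.all-filter (_∈? D) (List.allFin _))
  , λ {u} u∈D → All.lookup (f[xs]≤f[argmax] v₀ Ds) (∈-filter⁺ (_∈? D) (∈-allFin u) u∈D)
  where
  open Extrema ℤ.≤-totalOrder using (argmax; argmax-all; f[xs]≤f[argmax])
  Ds = List.filter (_∈? D) (List.allFin _)

module _ {n} (b : SetFn n) (m : Fin n → ℤ) where

  record ChainAbove (C₀ : Subset n) : Set where
    field
      k          : ℕ
      C          : Fin (suc k) → Subset n
      above      : C₀ ⊂ C zero
      increasing : ∀ j → C (inject₁ j) ⊂ C (suc j)
      last       : C (fromℕ k) ≡ ⊤
      top        : ∀ i → Top m (C i)
      tight      : ∀ i → TightP b m (C i)
      first-part : NearUniformOn m (C zero ─ C₀)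
      parts      : ∀ j → NearUniformOn m (part C (suc j))

  ChainStep : Subset n → Subset n → Set
  ChainStep C C′ = C ⊂ C′ × NearUniformOn m (C′ ─ C) × Top m C′ × TightP b m C′

  chain-end : ∀ {C C′} → ChainStep C C′ → C′ ≡ ⊤ → ChainAbove C
  chain-end {C′ = C′} (C⊂C′ , nu , top , tight) C′≡⊤ = record
    { k = 0 ; C = λ _ → C′ ; above = C⊂C′ ; increasing = λ () ; last = C′≡⊤
    ; top = λ _ → top ; tight = λ _ → tight ; first-part = nu ; parts = λ () }

  chain-cons : ∀ {C C′} → ChainStep C C′ → ChainAbove C′ → ChainAbove C
  chain-cons {C′ = C′} (C⊂C′ , nu , top′ , tight′) chain = record
    { k = suc k ; C = C″ ; above = C⊂C′ ; last = last
    ; increasing = λ { zero → above ; (suc j) → increasing j }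
    ; top = λ { zero → top′ ; (suc i) → top i }
    ; tight = λ { zero → tight′ ; (suc i) → tight i }
    ; first-part = nu
    ; parts = λ { zero → first-part ; (suc j) → parts j } }
    where
    open ChainAbove chain
    C″ : Fin (suc (suc k)) → Subset n
    C″ zero    = C′
    C″ (suc i) = C i

  chainAbove-⊥⇒chainCond : ChainAbove ⊥ → ChainCond b m
  chainAbove-⊥⇒chainCond chain = k , C , above , increasing , last , top , tight , nu
    where
    open ChainAbove chain
    nu : ∀ i → NearUniformOn m (part C i)
    nu zero    = subst (NearUniformOn m) (p─⊥≡p (C zero)) first-part
    nu (suc j) = parts j

module TightSets {n} (b : SetFn n) (m : Fin n → ℤ) (b⊥ : b ⊥ ≡ fin 0ℤ) (submodular : Submodular b)
                 (m∈B : InB b m) where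
  open BasePolyhedron b

  Tight : Subset n → Set
  Tight Z = b Z ≡ fin (tilde m Z)

  tight? : ∀ Z → Dec (Tight Z)
  tight? Z with b Z
  ... | ∞     = no λ ()
  ... | fin c = Dec.map′ (cong fin) fin-injective (c ℤ.≟ tilde m Z)

  tight-⊤ : Tight ⊤
  tight-⊤ = proj₁ m∈B

  tight-⊥ : Tight ⊥
  tight-⊥ = trans b⊥ (cong fin (sym (tilde-⊥ m)))

  tight-∩∪ : ∀ X Y → Tight X → Tight Y → Tight (X ∩ Y) × Tight (X ∪ Y)
  tight-∩∪ X Y tX tY with b (X ∩ Y) in b∩ | b (X ∪ Y) in b∪ | submodular X Y _ _ tX tY
  ... | fin a | fin c | fin≤fin a+c≤ = Product.map (cong fin ∘ sym) (cong fin ∘ sym)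
    (+-squeeze (tilde≤b m∈B b∩) (tilde≤b m∈B b∪) (subst (a + c ≤_) (sym (tilde-∩∪ m X Y)) a+c≤))
  ... | ∞     | _     | ()
  ... | fin _ | ∞     | ()

  ⋂-tight : ∀ {Zs} → All Tight Zs → Tight (⋂ Zs)
  ⋂-tight = List.foldr-preservesᵇ {P = Tight} {f = _∩_} (λ {X} {Y} tX tY → proj₁ (tight-∩∪ X Y tX tY)) tight-⊤

  ⋃-tight : ∀ {Zs} → All Tight Zs → Tight (⋃ Zs)
  ⋃-tight = List.foldr-preservesᵇ {P = Tight} {f = _∪_} (λ {X} {Y} tX tY → proj₂ (tight-∩∪ X Y tX tY)) tight-⊥

  tight⇒tightP-∁ : ∀ {D} → Tight D → TightP b m (∁ D)
  tight⇒tightP-∁ {D} tD = trans (compl-fin tight-⊤ (trans (cong b (∁-involutive D)) tD))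
    (cong just (begin
      tilde m ⊤ - tilde m D                 ≡⟨ cong (_- tilde m D) (trans (tilde-⊤ m) (sym (tilde-∁ m D))) ⟩
      tilde m D + tilde m (∁ D) - tilde m D ≡⟨ cancel (tilde m D) (tilde m (∁ D)) ⟩
      tilde m (∁ D)                         ∎))
    where
    open ≡-Reasoning
    cancel : ∀ a c → a + c - a ≡ c
    cancel = solve-∀

  -- Only sets containing s but not t gain under the step, and those are not tight.
  transfer∈B : ∀ {s t} (gap : m s + + 2 ≤ m t) → ¬ (∃ λ Z → Tight Z × s ∈ Z × t ∉ Z) →
    InB b (Transfer.m′ m gap)
  transfer∈B {s} {t} gap ∄Z = trans tight-⊤ (cong fin (trans (tilde-⊤ m) (trans (sym ∑-m′) (sym (tilde-⊤ m′)))))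
                            , bounded
    where
    open Transfer m gap

    no-gain : ∀ {Z} → Z ⊂ ⊤ → tilde (χ s) Z ≤ tilde (χ t) Z → fin (tilde m′ Z) ≤∞ b Z
    no-gain {Z} Z⊂⊤ χ̃s≤χ̃t = ≤-≤∞-trans m̃′Z≤m̃Z (proj₂ m∈B Z Z⊂⊤)
      where
      open ℤ.≤-Reasoning
      cancel : ∀ a c → a + c - c ≡ a
      cancel = solve-∀
      m̃′Z≤m̃Z : tilde m′ Z ≤ tilde m Z
      m̃′Z≤m̃Z = begin
        tilde m′ Z                                ≡⟨ tilde-m′ Z ⟩
        tilde m Z + tilde (χ s) Z - tilde (χ t) Z ≤⟨ ℤ.+-monoˡ-≤ (- tilde (χ t) Z) (ℤ.+-monoʳ-≤ (tilde m Z) χ̃s≤χ̃t) ⟩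
        tilde m Z + tilde (χ t) Z - tilde (χ t) Z ≡⟨ cancel (tilde m Z) (tilde (χ t) Z) ⟩
        tilde m Z                                 ∎

    bounded : ∀ Z → Z ⊂ ⊤ → fin (tilde m′ Z) ≤∞ b Z
    bounded Z Z⊂⊤ with s ∈? Z | t ∈? Z
    ... | yes s∈Z | yes t∈Z = no-gain Z⊂⊤ (ℤ.≤-reflexive (trans (tilde-χ-∈ s∈Z) (sym (tilde-χ-∈ t∈Z))))
    ... | no  s∉Z | yes t∈Z = no-gain Z⊂⊤ (subst₂ _≤_ (sym (tilde-χ-∉ s∉Z)) (sym (tilde-χ-∈ t∈Z)) (+≤+ ℕ.z≤n))
    ... | no  s∉Z | no  t∉Z = no-gain Z⊂⊤ (ℤ.≤-reflexive (trans (tilde-χ-∉ s∉Z) (sym (tilde-χ-∉ t∉Z))))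
    ... | yes s∈Z | no  t∉Z with b Z in bZ
    ...   | ∞     = _ ≤∞top
    ...   | fin c = fin≤fin (subst (_≤ c) (sym m̃′Z≡1+m̃Z) (ℤ.i<j⇒suc[i]≤j m̃Z<c))
      where
      m̃Z<c : tilde m Z < c
      m̃Z<c = ℤ.≤∧≢⇒< (tilde≤b m∈B bZ) (λ m̃Z≡c → ∄Z (Z , trans bZ (cong fin (sym m̃Z≡c)) , s∈Z , t∉Z))
      shift : ∀ a → a + 1ℤ - 0ℤ ≡ 1ℤ + a
      shift = solve-∀
      m̃′Z≡1+m̃Z : tilde m′ Z ≡ 1ℤ + tilde m Z
      m̃′Z≡1+m̃Z = trans (tilde-m′ Z)
        (trans (cong₂ (λ p q → tilde m Z + p - q) (tilde-χ-∈ s∈Z) (tilde-χ-∉ t∉Z)) (shift (tilde m Z)))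

  module _ (no-step : NoTighteningStep b m) where

    separate : ∀ {s t} → m s + + 2 ≤ m t → ∃ λ Z → Tight Z × s ∈ Z × t ∉ Z
    separate {s} {t} gap with anySubset? (λ Z → tight? Z ×-dec s ∈? Z ×-dec ¬? (t ∈? Z))
    ... | yes separating = separating
    ... | no  ∄Z         = ⊥-elim (no-step s t (gap , transfer∈B gap ∄Z))

    separator : ∀ s t → ∃ λ Z → Tight Z × s ∈ Z × (m s + + 2 ≤ m t → t ∉ Z)
    separator s t with (m s + + 2) ℤ.≤? m t
    ... | yes gap  = let Z , tZ , s∈Z , t∉Z = separate gap in Z , tZ , s∈Z , λ _ → t∉Z
    ... | no  ¬gap = ⊤ , tight-⊤ , ∈⊤ , λ gap → ⊥-elim (¬gap gap)

    cluster : Fin n → Subset n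
    cluster s = ⋂ (List.tabulate (λ t → proj₁ (separator s t)))

    cluster-tight : ∀ s → Tight (cluster s)
    cluster-tight s = ⋂-tight (All.tabulate⁺ (λ t → proj₁ (proj₂ (separator s t))))

    ∈-cluster : ∀ s → s ∈ cluster s
    ∈-cluster s = List.foldr-preservesᵇ {P = s ∈_} {f = _∩_} (λ s∈X s∈Y → x∈p∩q⁺ (s∈X , s∈Y)) ∈⊤
      (All.tabulate⁺ (λ t → proj₁ (proj₂ (proj₂ (separator s t)))))

    ∉-cluster : ∀ {s t} → m s + + 2 ≤ m t → t ∉ cluster s
    ∉-cluster {s} {t} gap = List.foldr-preservesᵒ {P = t ∉_} {f = _∩_}
      (λ X Y → Sum.[ (λ t∉X t∈X∩Y → t∉X (proj₁ (x∈p∩q⁻ X Y t∈X∩Y)))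
                   , (λ t∉Y t∈X∩Y → t∉Y (proj₂ (x∈p∩q⁻ X Y t∈X∩Y))) ])
      ⊤ _ (inj₂ (Any.tabulate⁺ t (proj₂ (proj₂ (proj₂ (separator s t))) gap)))

    Level : ℤ → Subset n → Set
    Level γ D = Tight D × (∀ u → m u < γ → u ∈ D) × (∀ t → γ < m t → t ∉ D)

    level : ∀ γ → ∃ (Level γ)
    level γ = ⋃ lowerSets , ⋃-tight (All.tabulate⁺ (proj₁ ∘ proj₂ ∘ lower)) , covers , avoids
      where
      lower : ∀ u → ∃ λ Z → Tight Z × (m u < γ → u ∈ Z) × (∀ t → γ < m t → t ∉ Z)
      lower u with m u ℤ.<? γ
      ... | yes mu<γ = cluster u , cluster-tight u , (λ _ → ∈-cluster u)
                     , λ t γ<mt → ∉-cluster (<-<⇒+2≤ mu<γ γ<mt)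
      ... | no  mu≮γ = ⊥ , tight-⊥ , (λ mu<γ → ⊥-elim (mu≮γ mu<γ)) , (λ _ _ → ∉⊥)
      lowerSets = List.tabulate (proj₁ ∘ lower)
      covers : ∀ u → m u < γ → u ∈ ⋃ lowerSets
      covers u mu<γ = List.foldr-preservesᵒ {P = u ∈_} {f = _∪_} (λ _ _ → x∈p∪q⁺) ⊥ lowerSets
        (inj₂ (Any.tabulate⁺ u (proj₁ (proj₂ (proj₂ (lower u))) mu<γ)))
      avoids : ∀ t → γ < m t → t ∉ ⋃ lowerSets
      avoids t γ<mt = List.foldr-preservesᵇ {P = t ∉_} {f = _∪_}
        (λ {X} {Y} t∉X t∉Y t∈X∪Y → Sum.[ t∉X , t∉Y ] (x∈p∪q⁻ X Y t∈X∪Y)) ∉⊥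
        (All.tabulate⁺ (λ u → proj₂ (proj₂ (proj₂ (lower u))) t γ<mt))

    level-≤ : ∀ {γ D v} → Level γ D → v ∈ D → m v ≤ γ
    level-≤ (_ , _ , avoids) v∈D = ℤ.≮⇒≥ (λ γ<mv → avoids _ γ<mv v∈D)

    level-≥ : ∀ {γ D u} → Level γ D → u ∉ D → γ ≤ m u
    level-≥ (_ , covers , _) u∉D = ℤ.≮⇒≥ (λ mu<γ → u∉D (covers _ mu<γ))

    level⇒top : ∀ {γ D} → Level γ D → Top m (∁ D)
    level⇒top lvl u v u∈∁D v∉∁D = ℤ.≤-trans (level-≤ lvl (x∉∁p⇒x∈p v∉∁D)) (level-≥ lvl (x∈∁p⇒x∉p u∈∁D))

    DownClosed : Subset n → Set
    DownClosed D = ∀ {u v} → v ∈ D → m u < m v → u ∈ D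

    level⇒downClosed : ∀ {γ D} → Level γ D → DownClosed D
    level⇒downClosed lvl@(_ , covers , _) v∈D mu<mv = covers _ (ℤ.<-≤-trans mu<mv (level-≤ lvl v∈D))

    -- D′ is a level set just below the maximum β of m on D, so m takes only the values β − 1
    -- and β on D ─ D′.
    peel : ∀ {D} → DownClosed D → Nonempty D →
      ∃ λ D′ → DownClosed D′ × D′ ⊂ D × ChainStep b m (∁ D) (∁ D′)
    peel {D} closed nonempty with argmax-in m nonempty
    ... | v₀ , v₀∈D , max with level (pred (m v₀))
    ... | D′ , lvl = D′ , level⇒downClosed lvl , D′⊂D
                   , p⊂q⇒∁p⊃∁q D′⊂D , near-uniform , level⇒top lvl , tight⇒tightP-∁ (proj₁ lvl)
      where
      D′⊂D : D′ ⊂ D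
      D′⊂D = (λ u∈D′ → closed v₀∈D (ℤ.i≤pred[j]⇒i<j (level-≤ lvl u∈D′)))
           , v₀ , v₀∈D , λ v₀∈D′ → ℤ.<-irrefl refl (ℤ.i≤pred[j]⇒i<j (level-≤ lvl v₀∈D′))
      near-uniform : NearUniformOn m (∁ D′ ─ ∁ D)
      near-uniform u v u∈ v∈ = begin
        m u                ≤⟨ max (x∉∁p⇒x∈p (x∈p─q⇒x∉q (∁ D′) (∁ D) u∈)) ⟩
        m v₀               ≡⟨ ℤ.suc-pred (m v₀) ⟨
        sucℤ (pred (m v₀)) ≤⟨ ℤ.suc-mono (level-≥ lvl (x∈∁p⇒x∉p (p─q⊆p (∁ D′) (∁ D) v∈))) ⟩
        sucℤ (m v)         ≡⟨ ℤ.+-comm 1ℤ (m v) ⟩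
        m v + 1ℤ           ∎
        where open ℤ.≤-Reasoning

    build : ∀ {D} → Acc _⊂_ D → DownClosed D → Nonempty D → ChainAbove b m (∁ D)
    build (acc rec) closed nonempty with peel closed nonempty
    ... | D′ , closed′ , D′⊂D , step with nonempty? D′
    ...   | yes nonempty′ = chain-cons b m step (build (rec D′⊂D) closed′ nonempty′)
    ...   | no  empty′    = chain-end b m step (⊆-antisym ⊆⊤ λ _ → x∉p⇒x∈∁p λ x∈D′ → empty′ (_ , x∈D′))

    noStep⇒chain : Fin n → ChainCond b m
    noStep⇒chain u = chainAbove-⊥⇒chainCond b m
      (subst (ChainAbove b m) ∁⊤≡⊥ (build (⊂-wellFounded ⊤) (λ _ _ → ∈⊤) (u , ∈⊤)))
      where
      ∁⊤≡⊥ : ∁ ⊤ ≡ ⊥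
      ∁⊤≡⊥ = Empty-unique λ (x , x∈∁⊤) → x∈∁p⇒x∉p x∈∁⊤ ∈⊤

theorem3p3 : ∀ (k : ℕ) (b : SetFn (suc k)) →
    b ⊥ ≡ fin 0ℤ → (∃ λ bS → b ⊤ ≡ fin bS) → Submodular b →
    ∀ (m : Fin (suc k) → ℤ) → InB b m →
      (NoTighteningStep b m ⇔ ChainCond b m)
      × (ChainCond b m ⇔ DecMin b m)
      × (DecMin b m ⇔ IncMax b m)
theorem3p3 k b b⊥ _ submodular m m∈B =
    mk⇔ noStep⇒chain (decMin⇒noStep ∘ chain⇒decMin)
  , mk⇔ chain⇒decMin (noStep⇒chain ∘ decMin⇒noStep)
  , mk⇔ (chain⇒incMax m∈B ∘ noStep⇒chain ∘ decMin⇒noStep) (chain⇒decMin ∘ noStep⇒chain ∘ incMax⇒noStep)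
  where
  noStep⇒chain : NoTighteningStep b m → ChainCond b m
  noStep⇒chain no-step = TightSets.noStep⇒chain b m b⊥ submodular m∈B no-step zero
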